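{- Let $T$ be a non-empty finite set of positive integers with largest element $c$. Let $m$ be the smallest nonnegative integer such that for all integers $i\ge m$, \[ \tfrac12 i^2+\left(\tfrac32-c\right)i+\left(1+\tfrac12 c-\tfrac32 c^2\right) > 0, \] and let $d$ be the maximum of $2c+m-1$ and $\max_{ -2c+2\le i\le c+m}\{f_T(i+c)-f_T(i)-f_T(i+1)+i+1\}$. Let $k$ be an integer with $k\ge 4c+d+1$ and \[ k > \max_{ -2c+2\le i\le c+d+2}\{f_T(i-1+c)-f_T(i-1)-f_T(i)+i+2c-1\}, \] and let $(a_n)_{n\ge1}$ be the $S$-LID sequence for $S=[k]\setminus(k-T)$. Then for every integer $n$ with $c+d+1\le n\le k+c+1+d$, \[ a_{n+1}+a_n > a_{n+c}+a_{n-d}. \]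
   Context: $[k]=\{1,\dots,k\}$ and $k-T=\{k-t:t\in T\}$. For a set $S$ of positive integers, the $S$-legal index difference ($S$-LID) sequence $(a_n)_{n\ge 1}$ is defined recursively: for each positive integer $n$, $a_n$ is the smallest positive integer that cannot be written as $\sum_{\ell\in L} a_\ell$ for some set $L \subseteq \{1,\dots,n-1\}$ such that $|i-j|\notin S$ for all $i,j\in L$ (the empty sum is $0$). For each positive integer $k$ write $(a^{(k)}_n)$ for the $([k]\setminus(k-T))$-LID sequence. For each integer $i$, $f_T(i)$ denotes the integer such that $a^{(k)}_{k+i}=k+f_T(i)$ for every integer $k$ with $k>-i$ and $k\ge i+2c-1$ (this value is independent of such $k$; e.g. $f_T(i)=i$ for $i\le -c+1$). -}

module Defs where

open import Data.Nat as ℕ using (ℕ; zero; suc; _≤_; _<_; ∣_-_∣)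
open import Data.Integer as ℤ using (ℤ; +_; -[1+_]; _+_; _-_; _*_; -_; _⊔_)
open import Data.List using (List; []; _∷_; map; foldr; upTo)
open import Data.Nat.ListAction using (sum)
open import Data.List.Membership.Propositional using (_∈_)
open import Data.List.Relation.Unary.All using (All)
open import Data.List.Relation.Unary.Unique.Propositional using (Unique)
open import Data.Product using (Σ; ∃; _×_; _,_)
open import Relation.Nullary using (¬_)
open import Relation.Binary.PropositionalEquality using (_≡_)

-- The set S = [k] \ (k - T), as a predicate on ℕ (T a finite set given as a list).
-- s ∈ k - T  iff  s = k - t for some t ∈ T  iff  s + t = k for some t ∈ T.
Sk : ℕ → List ℕ → ℕ → Set
Sk k T s = (1 ≤ s) × (s ≤ k) × ¬ (∃ λ t → t ∈ T × s ℕ.+ t ≡ k)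

Rep : (ℕ → Set) → (ℕ → ℕ) → ℕ → ℕ → Set
Rep S a n v =
  Σ (List ℕ) λ L →
    Unique L
    × All (λ l → (1 ≤ l) × (l < n)) L
    × (∀ i j → i ∈ L → j ∈ L → ¬ S ∣ i - j ∣)
    × sum (map a L) ≡ v

-- (a_n)_{n≥1} is the S-LID sequence (the value a 0 is irrelevant):
-- a_n is the smallest positive integer not representable from a_1..a_{n-1}.
IsLID : (ℕ → Set) → (ℕ → ℕ) → Set
IsLID S a = ∀ n → 1 ≤ n →
  (1 ≤ a n) × ¬ Rep S a n (a n) × (∀ v → 1 ≤ v → v ℕ.< a n → Rep S a n v)

-- integer-indexed view of a sequence (only used at positive indices)
at : (ℕ → ℕ) → ℤ → ℤ
at a z = + a ℤ.∣ z ∣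

-- f is f_T: a^{(k)}_{k+i} = k + f(i) for every positive integer k with
-- k > -i and k ≥ i + 2c - 1, where a^{(k)} is the ([k] \ (k-T))-LID sequence.
IsFT : List ℕ → ℕ → (ℤ → ℤ) → Set
IsFT T c f = ∀ (i : ℤ) (k : ℕ) (b : ℕ → ℕ) →
  1 ≤ k → - i ℤ.< + k → i + + (2 ℕ.* c) - + 1 ℤ.≤ + k →
  IsLID (Sk k T) b → at b (+ k + i) ≡ + k + f i

-- twice the quadratic  ½ i² + (3/2 - c) i + (1 + ½ c - 3/2 c²)
quad2 : ℕ → ℤ → ℤ
quad2 c i = i * i + (+ 3 - + (2 ℕ.* c)) * i + (+ 2 + + c - + (3 ℕ.* c ℕ.* c))

PosFrom : ℕ → ℕ → Set
PosFrom c m = ∀ (i : ℤ) → + m ℤ.≤ i → + 0 ℤ.< quad2 c i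

IsM : ℕ → ℕ → Set
IsM c m = PosFrom c m × (∀ m' → m' ℕ.< m → ¬ PosFrom c m')

clamp : ℤ → ℕ
clamp (+ n) = n
clamp -[1+ n ] = 0

rangeZ : ℤ → ℤ → List ℤ
rangeZ lo hi = map (λ j → lo + + j) (upTo (clamp (hi - lo + + 1)))

-- max_{lo ≤ i ≤ hi} g(i)  (used only with lo ≤ hi)
maxOver : ℤ → ℤ → (ℤ → ℤ) → ℤ
maxOver lo hi g = foldr (λ j acc → g j ⊔ acc) (g lo) (rangeZ lo hi)

dVal : ℕ → ℕ → (ℤ → ℤ) → ℤ
dVal c m f =
  (+ (2 ℕ.* c ℕ.+ m) - + 1)
  ⊔ maxOver (+ 2 - + (2 ℕ.* c)) (+ c + + m)
      (λ i → f (i + + c) - f i - f (i + + 1) + i + + 1)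

kBound : ℕ → ℤ → (ℤ → ℤ) → ℤ
kBound c d f =
  maxOver (+ 2 - + (2 ℕ.* c)) (+ c + d + + 2)
    (λ i → f (i - + 1 + + c) - f (i - + 1) - f i + i + + (2 ℕ.* c) - + 1)

{-# OPTIONS --safe #-}
-- While n + c ≤ k + 1, any two distinct indices below n differ by an element of S = [k] \ (k - T),
-- so only singletons are admissible and a_n = n.  Up to index k + r + 1 with c ≤ r, r + 1 + 2c ≤ k,
-- all indices lie in [1, 2(k - c)] and indices outside S are at least k - c apart, so admissible
-- sets have at most two elements; this forces a_{k+r+2} = a_{k+r+1} + r + 1, hence a quadratic
-- closed form for a beyond k + c.  The inequality then splits into three ranges of n: where a is
-- the identity it reduces to c ≤ d; up to k + c + m the relation a_{k+i} = k + f_T(i) turns it into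
-- the defining bound of d; beyond that the closed form together with a_{n-d} + (d - x) ≤ a_{k+c+1}
-- (for n = k + c + 1 + x) reduces it to positivity of the quadratic defining m.
module Submission where

open import Defs

module OnNaturals where
  open import Data.Nat
  open import Data.Nat.Properties
  open import Data.Nat.Tactic.RingSolver using (solve-∀)
  open import Data.List using (List; []; _∷_)
  open import Data.List.Membership.Propositional using (_∈_)
  open import Data.List.Relation.Unary.Any using (here; there)
  open import Data.List.Relation.Unary.All as All using (All; []; _∷_)
  open import Data.List.Relation.Unary.AllPairs using ([]; _∷_)
  open import Data.Product using (_,_; proj₁; proj₂)
  open import Data.Sum using (inj₁; inj₂)
  open import Data.Empty using (⊥; ⊥-elim)
  open import Function using (_∘_)
  open import Relation.Nullary using (¬_; Dec; yes; no)
  open import Relation.Binary.PropositionalEquality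
  open import Relation.Binary.Definitions using (tri<; tri≈; tri>)
  open import Algebra.Properties.CommutativeSemigroup +-commutativeSemigroup
    using () renaming (interchange to +-interchange)

  -- Linear side conditions are reduced, through this lemma, to a ring identity proved by solve-∀.
  ≤-by-identity : ∀ {A B C D} s → A ≤ B → D + A ≡ (C + B) + s → C ≤ D
  ≤-by-identity {A} {B} {C} {D} s A≤B eq = +-cancelʳ-≤ B C D (begin
    C + B       ≤⟨ m≤m+n (C + B) s ⟩
    C + B + s   ≡⟨ eq ⟨
    D + A       ≤⟨ +-monoʳ-≤ D A≤B ⟩
    D + B       ∎)
    where open ≤-Reasoning

  m∸n<w : ∀ {m n B w} → m ≤ B → B < n + w → n ≤ m → m ∸ n < w
  m∸n<w {m} {n} {w = w} m≤B B<n+w n≤m =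
    subst (m ∸ n <_) (m+n∸m≡n n w) (∸-monoˡ-< (≤-<-trans m≤B B<n+w) n≤m)

  ∣m-n∣<w : ∀ {m n B w} → m ≤ B → n ≤ B → B < m + w → B < n + w → ∣ m - n ∣ < w
  ∣m-n∣<w {m} {n} m≤B n≤B B<m+w B<n+w with ≤-total n m
  ... | inj₁ n≤m = subst (_< _) (sym (m≤n⇒∣n-m∣≡n∸m n≤m)) (m∸n<w m≤B B<n+w n≤m)
  ... | inj₂ m≤n = subst (_< _) (sym (m≤n⇒∣m-n∣≡n∸m m≤n)) (m∸n<w n≤B B<m+w m≤n)

  ∣m-n∣<D-low : ∀ {m n D} → 1 ≤ m → 1 ≤ n → m ≤ D → n ≤ D → ∣ m - n ∣ < D
  ∣m-n∣<D-low {D = D} m≥1 n≥1 m≤D n≤D = ∣m-n∣<w m≤D n≤D (+-monoˡ-≤ D m≥1) (+-monoˡ-≤ D n≥1)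

  ∣m-n∣<D-high : ∀ {m n D} → m ≤ D + D → n ≤ D + D → D < m → D < n → ∣ m - n ∣ < D
  ∣m-n∣<D-high {D = D} m≤2D n≤2D D<m D<n = ∣m-n∣<w m≤2D n≤2D (+-monoˡ-≤ D D<m) (+-monoˡ-≤ D D<n)

  no-three-points-apart : ∀ D x y z → 1 ≤ x → 1 ≤ y → 1 ≤ z → x ≤ D + D → y ≤ D + D → z ≤ D + D →
    D ≤ ∣ x - y ∣ → D ≤ ∣ x - z ∣ → D ≤ ∣ y - z ∣ → ⊥
  no-three-points-apart D x y z x≥1 y≥1 z≥1 x≤2D y≤2D z≤2D xy xz yz
    with x ≤? D | y ≤? D | z ≤? D
  ... | yes x≤D | yes y≤D | _       = <⇒≱ (∣m-n∣<D-low x≥1 y≥1 x≤D y≤D) xy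
  ... | yes x≤D | no _    | yes z≤D = <⇒≱ (∣m-n∣<D-low x≥1 z≥1 x≤D z≤D) xz
  ... | no _    | yes y≤D | yes z≤D = <⇒≱ (∣m-n∣<D-low y≥1 z≥1 y≤D z≤D) yz
  ... | yes _   | no y≰D  | no z≰D  = <⇒≱ (∣m-n∣<D-high y≤2D z≤2D (≰⇒> y≰D) (≰⇒> z≰D)) yz
  ... | no x≰D  | yes _   | no z≰D  = <⇒≱ (∣m-n∣<D-high x≤2D z≤2D (≰⇒> x≰D) (≰⇒> z≰D)) xz
  ... | no x≰D  | no y≰D  | _       = <⇒≱ (∣m-n∣<D-high x≤2D y≤2D (≰⇒> x≰D) (≰⇒> y≰D)) xy

  MiddleBound : (a : ℕ → ℕ) (k c m d : ℕ) → Set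
  MiddleBound a k c m d =
    ∀ n → 1 ≤ n → suc k < n + c + c → n ≤ k + c + m → a (n + c) + n + 1 ≤ d + a n + a (n + 1)

  QuadPositiveFrom : (c m : ℕ) → Set
  QuadPositiveFrom c m = ∀ x → m ≤ x → suc (2 * c * x + 3 * c * c) ≤ x * x + 3 * x + 2 + c

  module LIDSequence (S : ℕ → Set) (0∉S : ¬ S 0) (a : ℕ → ℕ) (lid : IsLID S a) where

    Rep-mono : ∀ {n n′ v} → n ≤ n′ → Rep S a n v → Rep S a n′ v
    Rep-mono n≤n′ (L , uniq , bounds , indep , sum≡) =
      L , uniq , All.map (λ { (l≥1 , l<n) → l≥1 , <-≤-trans l<n n≤n′ }) bounds , indep , sum≡

    Rep-singleton : ∀ {n} y → 1 ≤ y → y < n → Rep S a n (a y)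
    Rep-singleton y y≥1 y<n = y ∷ [] , [] ∷ [] , (y≥1 , y<n) ∷ [] , indep , +-identityʳ (a y)
      where
      indep : ∀ i j → i ∈ y ∷ [] → j ∈ y ∷ [] → ¬ S ∣ i - j ∣
      indep _ _ (here refl) (here refl) = 0∉S ∘ subst S (∣n-n∣≡0 y)

    Rep-pair : ∀ {n} x y → 1 ≤ x → x < y → y < n → ¬ S (y ∸ x) → Rep S a n (a x + a y)
    Rep-pair x y x≥1 x<y y<n y∸x∉S =
      x ∷ y ∷ [] , (<⇒≢ x<y ∷ []) ∷ [] ∷ [] ,
      (x≥1 , <-trans x<y y<n) ∷ (≤-trans x≥1 (<⇒≤ x<y) , y<n) ∷ [] ,
      indep , cong (a x +_) (+-identityʳ (a y))
      where
      indep : ∀ i j → i ∈ x ∷ y ∷ [] → j ∈ x ∷ y ∷ [] → ¬ S ∣ i - j ∣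
      indep _ _ (here refl)         (here refl)         = 0∉S ∘ subst S (∣n-n∣≡0 x)
      indep _ _ (there (here refl)) (there (here refl)) = 0∉S ∘ subst S (∣n-n∣≡0 y)
      indep _ _ (here refl)         (there (here refl)) = y∸x∉S ∘ subst S (m≤n⇒∣m-n∣≡n∸m (<⇒≤ x<y))
      indep _ _ (there (here refl)) (here refl)         = y∸x∉S ∘ subst S (m≤n⇒∣n-m∣≡n∸m (<⇒≤ x<y))

    Rep-below⇒≤a : ∀ n B → 1 ≤ n → (∀ v → 1 ≤ v → v < B → Rep S a n v) → B ≤ a n
    Rep-below⇒≤a n B n≥1 rep = ≮⇒≥ λ a<B → proj₁ (proj₂ (lid n n≥1)) (rep (a n) (proj₁ (lid n n≥1)) a<B)

    ¬Rep⇒a≤ : ∀ n V → 1 ≤ n → 1 ≤ V → ¬ Rep S a n V → a n ≤ V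
    ¬Rep⇒a≤ n V n≥1 V≥1 ¬rep = ≮⇒≥ λ V<a → ¬rep (proj₂ (proj₂ (lid n n≥1)) V V≥1 V<a)

    Rep-below-a : ∀ {n v} → 1 ≤ n → 1 ≤ v → v < a n → Rep S a (suc n) v
    Rep-below-a {n} n≥1 v≥1 v<a = Rep-mono (n≤1+n n) (proj₂ (proj₂ (lid n n≥1)) _ v≥1 v<a)

    a<a-suc : ∀ n → 1 ≤ n → a n < a (suc n)
    a<a-suc n n≥1 = Rep-below⇒≤a (suc n) (suc (a n)) z<s rep
      where
      rep : ∀ v → 1 ≤ v → v < suc (a n) → Rep S a (suc n) v
      rep v v≥1 v≤a with m≤n⇒m<n∨m≡n (s≤s⁻¹ v≤a)
      ... | inj₁ v<a  = Rep-below-a n≥1 v≥1 v<a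
      ... | inj₂ refl = Rep-singleton n n≥1 ≤-refl

    a+e≤a[+e] : ∀ q e → 1 ≤ q → a q + e ≤ a (q + e)
    a+e≤a[+e] q zero    q≥1 rewrite +-identityʳ (a q) | +-identityʳ q = ≤-refl
    a+e≤a[+e] q (suc e) q≥1 rewrite +-suc (a q) e | +-suc q e =
      ≤-trans (s≤s (a+e≤a[+e] q e q≥1)) (a<a-suc (q + e) (≤-trans q≥1 (m≤m+n q e)))

    a-mono : ∀ {q r} → 1 ≤ q → q ≤ r → a q ≤ a r
    a-mono {q} {r} q≥1 q≤r = begin
      a q               ≤⟨ m≤m+n (a q) (r ∸ q) ⟩
      a q + (r ∸ q)     ≤⟨ a+e≤a[+e] q (r ∸ q) q≥1 ⟩
      a (q + (r ∸ q))   ≡⟨ cong a (m+[n∸m]≡n q≤r) ⟩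
      a r               ∎
      where open ≤-Reasoning

    n≤a : ∀ n → 1 ≤ n → n ≤ a n
    n≤a (suc p) _ = ≤-trans (+-monoˡ-≤ p (proj₁ (lid 1 ≤-refl))) (a+e≤a[+e] 1 p ≤-refl)

  module SkSequence (T : List ℕ) (c k : ℕ) (T≥1 : All (1 ≤_) T) (T≤c : All (_≤ c) T) (k≥1 : 1 ≤ k)
                    (a : ℕ → ℕ) (lid : IsLID (Sk k T) a) where

    0∉Sk : ¬ Sk k T 0
    0∉Sk (() , _)

    open LIDSequence (Sk k T) 0∉Sk a lid public

    s+c<k⇒s∈Sk : ∀ {s} → 1 ≤ s → s + c < k → Sk k T s
    s+c<k⇒s∈Sk {s} s≥1 s+c<k = s≥1 , ≤-trans (m≤m+n s c) (<⇒≤ s+c<k) , λ { (t , t∈T , s+t≡k) →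
      <⇒≱ s+c<k (subst (_≤ s + c) s+t≡k (+-monoʳ-≤ s (All.lookup T≤c t∈T))) }

    k∈Sk : Sk k T k
    k∈Sk = k≥1 , ≤-refl , λ { (t , t∈T , k+t≡k) → <⇒≢ (m<m+n k (All.lookup T≥1 t∈T)) (sym k+t≡k) }

    k<s⇒s∉Sk : ∀ {s} → k < s → ¬ Sk k T s
    k<s⇒s∉Sk k<s (_ , s≤k , _) = <⇒≱ k<s s≤k

    s∉Sk⇒k≤s+c : ∀ {s} → 1 ≤ s → ¬ Sk k T s → k ≤ s + c
    s∉Sk⇒k≤s+c s≥1 s∉Sk = ≮⇒≥ (s∉Sk ∘ s+c<k⇒s∈Sk s≥1)

    ∣x-y∣∉Sk⇒k≤∣x-y∣+c : ∀ {x y} → x ≢ y → ¬ Sk k T ∣ x - y ∣ → k ≤ ∣ x - y ∣ + c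
    ∣x-y∣∉Sk⇒k≤∣x-y∣+c x≢y = s∉Sk⇒k≤s+c (n≢0⇒n>0 (x≢y ∘ ∣m-n∣≡0⇒m≡n))

    far-pair⇒x≤s+c : ∀ {x y s} → x < y → y ≤ k + s → ¬ Sk k T (y ∸ x) → x ≤ s + c
    far-pair⇒x≤s+c {x} {y} {s} x<y y≤ y∸x∉Sk = +-cancelʳ-≤ k x (s + c) (begin
      x + k             ≤⟨ +-monoʳ-≤ x (s∉Sk⇒k≤s+c (m<n⇒0<n∸m x<y) y∸x∉Sk) ⟩
      x + (y ∸ x + c)   ≡⟨ +-assoc x (y ∸ x) c ⟨
      x + (y ∸ x) + c   ≡⟨ cong (_+ c) (m+[n∸m]≡n (<⇒≤ x<y)) ⟩
      y + c             ≤⟨ +-monoˡ-≤ c y≤ ⟩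
      k + s + c         ≡⟨ trans (+-assoc k s c) (+-comm k (s + c)) ⟩
      s + c + k         ∎)
      where open ≤-Reasoning

    ¬Rep-self : ∀ q → q + c ≤ k → (∀ y → 1 ≤ y → y ≤ q → a y ≡ y) → ¬ Rep (Sk k T) a (suc q) (suc q)
    ¬Rep-self q q+c≤k a-id ([] , _ , _ , _ , ())
    ¬Rep-self q q+c≤k a-id (y ∷ [] , _ , (y≥1 , y<) ∷ [] , _ , sum≡) =
      <⇒≢ y< (trans (sym (a-id y y≥1 (s≤s⁻¹ y<))) (trans (sym (+-identityʳ (a y))) sum≡))
    ¬Rep-self q q+c≤k a-id (x ∷ y ∷ _ , (x≢y ∷ _) ∷ _ , (x≥1 , x<) ∷ (y≥1 , y<) ∷ _ , indep , _) =
      <⇒≱ (<-≤-trans (+-monoˡ-< c (∣m-n∣<D-low x≥1 y≥1 (s≤s⁻¹ x<) (s≤s⁻¹ y<))) q+c≤k)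
          (∣x-y∣∉Sk⇒k≤∣x-y∣+c x≢y (indep x y (here refl) (there (here refl))))

    a-id-upTo : ∀ p → p + c ≤ suc k → ∀ y → 1 ≤ y → y ≤ p → a y ≡ y
    a-id-upTo zero    _     y y≥1 y≤0 = ⊥-elim (<⇒≱ y≥1 y≤0)
    a-id-upTo (suc q) bound y y≥1 y≤ with m≤n⇒m<n∨m≡n y≤
    ... | inj₁ y<   = a-id-upTo q (≤-trans (n≤1+n _) bound) y y≥1 (s≤s⁻¹ y<)
    ... | inj₂ refl = ≤-antisym (¬Rep⇒a≤ (suc q) (suc q) z<s z<s ¬rep) (n≤a (suc q) z<s)
      where
      ¬rep : ¬ Rep (Sk k T) a (suc q) (suc q)
      ¬rep = ¬Rep-self q (s≤s⁻¹ bound) (a-id-upTo q (≤-trans (n≤1+n _) bound))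

    a-id : ∀ {p} → 1 ≤ p → p + c ≤ suc k → a p ≡ p
    a-id {p} p≥1 bound = a-id-upTo p bound p p≥1 ≤-refl

    a[k+r]+r≤a[k+r+1] : ∀ r → r + c ≤ 2 + k → a (k + r) + r ≤ a (suc (k + r))
    a[k+r]+r≤a[k+r+1] r bound = Rep-below⇒≤a (suc (k + r)) (a (k + r) + r) z<s rep
      where
      k+r≥1 : 1 ≤ k + r
      k+r≥1 = ≤-trans k≥1 (m≤m+n k r)
      rep-above : ∀ x → x < r → Rep (Sk k T) a (suc (k + r)) (a (k + r) + x)
      rep-above zero _ =
        subst (Rep (Sk k T) a _) (sym (+-identityʳ _)) (Rep-singleton (k + r) k+r≥1 ≤-refl)
      rep-above (suc x) x<r = subst (Rep (Sk k T) a _) ax+a≡a+x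
        (Rep-pair (suc x) (k + r) z<s (<-≤-trans x<r (m≤n+m r k)) ≤-refl (k<s⇒s∉Sk k<gap))
        where
        k<gap : k < k + r ∸ suc x
        k<gap = subst (_< k + r ∸ suc x) (m+n∸n≡m k (suc x)) (∸-monoˡ-< (+-monoʳ-< k x<r) (m≤n+m (suc x) k))
        ax+a≡a+x : a (suc x) + a (k + r) ≡ a (k + r) + suc x
        ax+a≡a+x = trans (cong (_+ a (k + r)) (a-id z<s (s≤s⁻¹ (<-≤-trans (+-monoˡ-< c x<r) bound))))
                         (+-comm (suc x) (a (k + r)))
      rep : ∀ v → 1 ≤ v → v < a (k + r) + r → Rep (Sk k T) a (suc (k + r)) v
      rep v v≥1 v< with v <? a (k + r)
      ... | yes v<a = Rep-below-a k+r≥1 v≥1 v<a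
      ... | no v≮a  = subst (Rep (Sk k T) a _) a+[v∸a]≡v
        (rep-above (v ∸ a (k + r)) (+-cancelˡ-< (a (k + r)) _ r (subst (_< _) (sym a+[v∸a]≡v) v<)))
        where
        a+[v∸a]≡v : a (k + r) + (v ∸ a (k + r)) ≡ v
        a+[v∸a]≡v = m+[n∸m]≡n (≮⇒≥ v≮a)

    module _ {r : ℕ} (c≤r : c ≤ r) (r+2c<k : suc r + (c + c) ≤ k) where

      private
        V : ℕ
        V = a (k + suc r) + suc r

        x≤r+c⇒x+c≤1+k : ∀ {x} → x ≤ suc r + c → x + c ≤ suc k
        x≤r+c⇒x+c≤1+k {x} x≤ = begin
          x + c             ≤⟨ +-monoˡ-≤ c x≤ ⟩
          suc r + c + c     ≡⟨ +-assoc (suc r) c c ⟩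
          suc r + (c + c)   ≤⟨ r+2c<k ⟩
          k                 ≤⟨ n≤1+n k ⟩
          suc k             ∎
          where open ≤-Reasoning

      pair-with-top≢V : ∀ {x} → 1 ≤ x → x ≤ suc r + c → k + suc r ∸ x ≢ k → a x + a (k + suc r) ≢ V
      pair-with-top≢V {x} x≥1 x≤ gap≢k sum≡V = gap≢k (begin
        k + suc r ∸ x       ≡⟨ cong (λ z → k + z ∸ x) (trans (sym ax≡r) (a-id x≥1 (x≤r+c⇒x+c≤1+k x≤))) ⟩
        k + x ∸ x           ≡⟨ m+n∸n≡m k x ⟩
        k                   ∎)
        where
        open ≡-Reasoning
        ax≡r : a x ≡ suc r
        ax≡r = +-cancelʳ-≡ (a (k + suc r)) (a x) (suc r) (trans sum≡V (+-comm _ (suc r)))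

      pair-below-top<V : ∀ {x y} → 1 ≤ x → x ≤ y → y ≤ k + r → x ≤ r + c → a x + a y < V
      pair-below-top<V {x} {y} x≥1 x≤y y≤ x≤ = begin-strict
        a x + a y                 ≡⟨ cong (_+ a y) (a-id x≥1 (x≤r+c⇒x+c≤1+k (≤-trans x≤ (n≤1+n _)))) ⟩
        x + a y                   ≤⟨ +-mono-≤ x≤ (a-mono (≤-trans x≥1 x≤y) y≤) ⟩
        r + c + a (k + r)         <⟨ +-monoˡ-< (a (k + r)) (+-monoʳ-< r (s≤s c≤r)) ⟩
        r + suc r + a (k + r)     ≡⟨ +-comm (r + suc r) (a (k + r)) ⟩
        a (k + r) + (r + suc r)   ≡⟨ +-assoc (a (k + r)) r (suc r) ⟨
        a (k + r) + r + suc r     ≤⟨ +-monoˡ-≤ (suc r) (a[k+r]+r≤a[k+r+1] r r+c≤2+k) ⟩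
        a (suc (k + r)) + suc r   ≡⟨ cong (λ z → a z + suc r) (+-suc k r) ⟨
        V                         ∎
        where
        open ≤-Reasoning
        r+c≤2+k : r + c ≤ 2 + k
        r+c≤2+k = ≤-trans (+-monoʳ-≤ r (m≤m+n c c))
                    (≤-trans (n≤1+n _) (≤-trans r+2c<k (≤-trans (n≤1+n k) (n≤1+n (suc k)))))

      pair≢V : ∀ {x y} → 1 ≤ x → x < y → y ≤ k + suc r → ¬ Sk k T (y ∸ x) → a x + a y ≢ V
      pair≢V {x} {y} x≥1 x<y y≤ y∸x∉Sk with m≤n⇒m<n∨m≡n y≤
      ... | inj₂ refl = pair-with-top≢V x≥1 (far-pair⇒x≤s+c x<y y≤ y∸x∉Sk)
                          (λ gap≡k → y∸x∉Sk (subst (Sk k T) (sym gap≡k) k∈Sk))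
      ... | inj₁ y<   = <⇒≢ (pair-below-top<V x≥1 (<⇒≤ x<y) y≤k+r (far-pair⇒x≤s+c x<y y≤k+r y∸x∉Sk))
        where
        y≤k+r : y ≤ k + r
        y≤k+r = s≤s⁻¹ (subst (y <_) (+-suc k r) y<)

      distinct-pair≢V : ∀ {x y} → x ≢ y → 1 ≤ x → x ≤ k + suc r → 1 ≤ y → y ≤ k + suc r →
                        ¬ Sk k T ∣ x - y ∣ → a x + a y ≢ V
      distinct-pair≢V {x} {y} x≢y x≥1 x≤ y≥1 y≤ ∣x-y∣∉Sk with <-cmp x y
      ... | tri< x<y _ _ = pair≢V x≥1 x<y y≤ (∣x-y∣∉Sk ∘ subst (Sk k T) (sym (m≤n⇒∣m-n∣≡n∸m (<⇒≤ x<y))))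
      ... | tri≈ _ x≡y _ = ⊥-elim (x≢y x≡y)
      ... | tri> _ _ y<x = pair≢V y≥1 y<x x≤ (∣x-y∣∉Sk ∘ subst (Sk k T) (sym (m≤n⇒∣n-m∣≡n∸m (<⇒≤ y<x))))
                           ∘ trans (+-comm (a y) (a x))

      ¬three-far-indices : ∀ {x y z} → 1 ≤ x → x ≤ k + suc r → 1 ≤ y → y ≤ k + suc r → 1 ≤ z → z ≤ k + suc r →
        x ≢ y → x ≢ z → y ≢ z → ¬ Sk k T ∣ x - y ∣ → ¬ Sk k T ∣ x - z ∣ → ¬ Sk k T ∣ y - z ∣ → ⊥
      ¬three-far-indices x≥1 x≤ y≥1 y≤ z≥1 z≤ x≢y x≢z y≢z xy∉ xz∉ yz∉ =
        no-three-points-apart D _ _ _ x≥1 y≥1 z≥1 (≤-trans x≤ top≤2D) (≤-trans y≤ top≤2D) (≤-trans z≤ top≤2D)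
          (far x≢y xy∉) (far x≢z xz∉) (far y≢z yz∉)
        where
        D : ℕ
        D = k ∸ c
        k≡D+c : k ≡ D + c
        k≡D+c = sym (m∸n+n≡m (≤-trans (m≤n+m c (suc r + c))
                                      (≤-trans (≤-reflexive (+-assoc (suc r) c c)) r+2c<k)))
        far : ∀ {u v} → u ≢ v → ¬ Sk k T ∣ u - v ∣ → D ≤ ∣ u - v ∣
        far u≢v ∉ = +-cancelʳ-≤ c D _ (subst (_≤ _) k≡D+c (∣x-y∣∉Sk⇒k≤∣x-y∣+c u≢v ∉))
        top≤2D : k + suc r ≤ D + D
        top≤2D = +-cancelʳ-≤ (c + c) _ _ (begin
          k + suc r + (c + c)     ≡⟨ +-assoc k (suc r) (c + c) ⟩
          k + (suc r + (c + c))   ≤⟨ +-monoʳ-≤ k r+2c<k ⟩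
          k + k                   ≡⟨ cong₂ _+_ k≡D+c k≡D+c ⟩
          D + c + (D + c)         ≡⟨ +-interchange D c D c ⟩
          D + D + (c + c)         ∎)
          where open ≤-Reasoning

      ¬Rep-V : ¬ Rep (Sk k T) a (suc (k + suc r)) V
      ¬Rep-V ([] , _ , _ , _ , 0≡V) = <⇒≢ (≤-trans z<s (m≤n+m (suc r) _)) 0≡V
      ¬Rep-V (y ∷ [] , _ , (y≥1 , y<) ∷ [] , _ , sum≡V) =
        <⇒≢ (≤-<-trans (a-mono y≥1 (s≤s⁻¹ y<)) (m<m+n _ z<s)) (trans (sym (+-identityʳ (a y))) sum≡V)
      ¬Rep-V (x ∷ y ∷ [] , (x≢y ∷ []) ∷ _ , (x≥1 , x<) ∷ (y≥1 , y<) ∷ [] , indep , sum≡V) =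
        distinct-pair≢V x≢y x≥1 (s≤s⁻¹ x<) y≥1 (s≤s⁻¹ y<) (indep x y (here refl) (there (here refl)))
          (trans (cong (a x +_) (sym (+-identityʳ (a y)))) sum≡V)
      ¬Rep-V (x ∷ y ∷ z ∷ _ , (x≢y ∷ x≢z ∷ _) ∷ (y≢z ∷ _) ∷ _ ,
              (x≥1 , x<) ∷ (y≥1 , y<) ∷ (z≥1 , z<) ∷ _ , indep , _) =
        ¬three-far-indices x≥1 (s≤s⁻¹ x<) y≥1 (s≤s⁻¹ y<) z≥1 (s≤s⁻¹ z<) x≢y x≢z y≢z
          (indep x y (here refl) (there (here refl)))
          (indep x z (here refl) (there (there (here refl))))
          (indep y z (there (here refl)) (there (there (here refl))))

      a[k+r+2]≤a[k+r+1]+r+1 : a (suc (k + suc r)) ≤ a (k + suc r) + suc r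
      a[k+r+2]≤a[k+r+1]+r+1 = ¬Rep⇒a≤ _ _ z<s (≤-trans z<s (m≤n+m (suc r) _)) ¬Rep-V

    a-step : ∀ {r} → c ≤ r → suc r + (c + c) ≤ k → a (suc (k + suc r)) ≡ a (k + suc r) + suc r
    a-step {r} c≤r r+2c<k = ≤-antisym (a[k+r+2]≤a[k+r+1]+r+1 c≤r r+2c<k) (a[k+r]+r≤a[k+r+1] (suc r) r+c≤)
      where
      r+c≤ : suc r + c ≤ 2 + k
      r+c≤ = ≤-trans (+-monoʳ-≤ (suc r) (m≤m+n c c)) (≤-trans r+2c<k (≤-trans (n≤1+n k) (n≤1+n (suc k))))

    a-closed-form : ∀ y → y + (c + (c + c)) ≤ k →
      2 * a (k + suc (c + y)) + c * suc c ≡ 2 * a (k + suc c) + (c + y) * suc (c + y)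
    a-closed-form zero    _     rewrite +-identityʳ c = refl
    a-closed-form (suc y) bound = begin
      2 * a (k + suc (c + suc y)) + c * suc c
        ≡⟨ cong (λ z → 2 * a z + c * suc c) index≡ ⟩
      2 * a (suc (k + suc (c + y))) + c * suc c
        ≡⟨ cong (λ z → 2 * z + c * suc c) (a-step (m≤m+n c y) bound′) ⟩
      2 * (a (k + suc (c + y)) + suc (c + y)) + c * suc c
        ≡⟨ split-off (a (k + suc (c + y))) c (suc (c + y)) ⟩
      (2 * a (k + suc (c + y)) + c * suc c) + 2 * suc (c + y)
        ≡⟨ cong (_+ 2 * suc (c + y)) (a-closed-form y (≤-trans (n≤1+n _) bound)) ⟩
      (2 * a (k + suc c) + (c + y) * suc (c + y)) + 2 * suc (c + y)
        ≡⟨ next-pronic (a (k + suc c)) c y ⟩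
      2 * a (k + suc c) + (c + suc y) * suc (c + suc y) ∎
      where
      open ≡-Reasoning
      index≡ : k + suc (c + suc y) ≡ suc (k + suc (c + y))
      index≡ = trans (cong (λ z → k + suc z) (+-suc c y)) (+-suc k (suc (c + y)))
      rearrange : ∀ u v → suc v + (u + (u + u)) ≡ suc (u + v) + (u + u)
      rearrange = solve-∀
      bound′ : suc (c + y) + (c + c) ≤ k
      bound′ = subst (_≤ k) (rearrange c y) bound
      split-off : ∀ A u z → 2 * (A + z) + u * suc u ≡ (2 * A + u * suc u) + 2 * z
      split-off = solve-∀
      next-pronic : ∀ A u v →
        (2 * A + (u + v) * suc (u + v)) + 2 * suc (u + v) ≡ 2 * A + (u + suc v) * suc (u + suc v)
      next-pronic = solve-∀

    module _ {m d : ℕ} (c≥1 : 1 ≤ c) (2c+m≤1+d : c + c + m ≤ suc d) (4c+d<k : 4 * c + d + 1 ≤ k) where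

      private
        c≤d : c ≤ d
        c≤d = s≤s⁻¹ (subst (_≤ suc d) (+-comm c 1)
                (≤-trans (+-monoʳ-≤ c c≥1) (≤-trans (m≤m+n (c + c) m) 2c+m≤1+d)))

      target-identity-range : ∀ {q} → 1 ≤ q → q + d + c + c ≤ suc k →
        a (q + d + c) + a q < a (q + d + 1) + a (q + d)
      target-identity-range {q} q≥1 bound = begin-strict
        a (q + d + c) + a q       ≡⟨ cong₂ _+_ (a-id (≤-trans n≥1 (m≤m+n _ c)) bound) (a-id q≥1 q+c≤) ⟩
        q + d + c + q             <⟨ ≤-by-identity 0 c≤d (rearrange q d c) ⟩
        q + d + 1 + (q + d)       ≡⟨ cong₂ _+_ (a-id (≤-trans n≥1 (m≤m+n _ 1)) n+1+c≤) (a-id n≥1 n+c≤) ⟨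
        a (q + d + 1) + a (q + d) ∎
        where
        open ≤-Reasoning
        rearrange : ∀ u v w → u + v + 1 + (u + v) + w ≡ suc (u + v + w + u) + v + 0
        rearrange = solve-∀
        n≥1 : 1 ≤ q + d
        n≥1 = ≤-trans q≥1 (m≤m+n q d)
        n+c≤ : q + d + c ≤ suc k
        n+c≤ = ≤-trans (m≤m+n _ c) bound
        q+c≤ : q + c ≤ suc k
        q+c≤ = ≤-trans (+-monoˡ-≤ c (m≤m+n q d)) n+c≤
        n+1+c≤ : q + d + 1 + c ≤ suc k
        n+1+c≤ = ≤-trans (+-monoˡ-≤ c (+-monoʳ-≤ (q + d) c≥1)) bound

      target-middle-range : ∀ {q} → 1 ≤ q → q + c ≤ suc k →
        a (q + d + c) + (q + d) + 1 ≤ d + a (q + d) + a (q + d + 1) →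
        a (q + d + c) + a q < a (q + d + 1) + a (q + d)
      target-middle-range {q} q≥1 q+c≤ bound rewrite a-id q≥1 q+c≤ =
        ≤-by-identity 0 bound (rearrange (a (q + d + c)) (a (q + d + 1)) (a (q + d)) q d)
        where
        rearrange : ∀ X Y₁ Y₀ u v → Y₁ + Y₀ + (X + (u + v) + 1) ≡ suc (X + u) + (v + Y₀ + Y₁) + 0
        rearrange = solve-∀

      -- Doubled, the closed form has no halves; after the terms 2 a_{k+c+1} cancel, what remains
      -- is the quadratic defining m.
      target-quadratic-range : ∀ {q} x → 1 ≤ q → q + d ≡ k + suc (c + x) → x ≤ d →
        suc (2 * c * x + 3 * c * c) ≤ x * x + 3 * x + 2 + c →
        a (q + d + c) + a q < a (q + d + 1) + a (q + d)
      target-quadratic-range {q} x q≥1 q+d≡ x≤d quad = *-cancelˡ-< 2 _ _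
        (≤-by-identity ((e + e) + 2 * c * x)
          (+-mono-≤ (+-mono-≤ (+-mono-≤ (+-mono-≤ (≤-reflexive F₁) (≤-reflexive (sym F₂)))
                                        (≤-reflexive (sym F₀)))
                              (+-mono-≤ aq+e≤A aq+e≤A))
                    quad)
          (balance (a (q + d + c)) (a q) (a (q + d + 1)) (a (q + d)) A c x e))
        where
        index+ : ∀ k c x y → k + suc (c + (x + y)) ≡ k + suc (c + x) + y
        index+ = solve-∀
        balance : ∀ X Aq Y₁ Y₀ A c x e →
          2 * (Y₁ + Y₀) + ((((2 * X + c * suc c) + (2 * A + (c + suc x) * suc (c + suc x)))
              + (2 * A + (c + x) * suc (c + x))) + ((Aq + e) + (Aq + e)) + suc (2 * c * x + 3 * c * c))
          ≡ suc (2 * (X + Aq)) + ((((2 * A + (c + (x + c)) * suc (c + (x + c))) + (2 * Y₁ + c * suc c))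
              + (2 * Y₀ + c * suc c)) + (A + A) + (x * x + 3 * x + 2 + c)) + ((e + e) + 2 * c * x)
        balance = solve-∀
        A : ℕ
        A = a (k + suc c)
        e : ℕ
        e = d ∸ x
        closed : ∀ y → y ≤ x + c → 2 * a (k + suc (c + y)) + c * suc c ≡ 2 * A + (c + y) * suc (c + y)
        closed y y≤ = a-closed-form y (≤-by-identity 1 (+-mono-≤ y≤ (+-mono-≤ x≤d 4c+d<k)) (shift y x c d k))
          where
          shift : ∀ y x c d k → k + (y + (x + (4 * c + d + 1))) ≡ y + (c + (c + c)) + (x + c + (d + k)) + 1
          shift = solve-∀
        closed-at : ∀ {i} y → y ≤ x + c → k + suc (c + y) ≡ i →
                    2 * a i + c * suc c ≡ 2 * A + (c + y) * suc (c + y)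
        closed-at y y≤ refl = closed y y≤
        F₁ : 2 * a (q + d + c) + c * suc c ≡ 2 * A + (c + (x + c)) * suc (c + (x + c))
        F₁ = closed-at (x + c) ≤-refl (trans (index+ k c x c) (cong (_+ c) (sym q+d≡)))
        F₂ : 2 * a (q + d + 1) + c * suc c ≡ 2 * A + (c + suc x) * suc (c + suc x)
        F₂ = closed-at (suc x) (subst (_≤ x + c) (+-comm x 1) (+-monoʳ-≤ x c≥1))
               (trans (cong (λ z → k + suc (c + z)) (+-comm 1 x))
                      (trans (index+ k c x 1) (cong (_+ 1) (sym q+d≡))))
        F₀ : 2 * a (q + d) + c * suc c ≡ 2 * A + (c + x) * suc (c + x)
        F₀ = closed-at x (m≤m+n x c) (sym q+d≡)
        q+e≡ : q + e ≡ k + suc c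
        q+e≡ = +-cancelʳ-≡ x _ _ (begin
          q + e + x           ≡⟨ trans (+-assoc q e x) (cong (q +_) (m∸n+n≡m x≤d)) ⟩
          q + d               ≡⟨ q+d≡ ⟩
          k + suc (c + x)     ≡⟨ index+ k c 0 x ⟩
          k + suc (c + 0) + x ≡⟨ cong (λ z → k + suc z + x) (+-identityʳ c) ⟩
          k + suc c + x       ∎)
          where open ≡-Reasoning
        aq+e≤A : a q + e ≤ A
        aq+e≤A = subst (λ i → a q + e ≤ a i) q+e≡ (a+e≤a[+e] q e q≥1)

      target-by-range : MiddleBound a k c m d → QuadPositiveFrom c m →
        ∀ q → c + 1 ≤ q → q ≤ suc (k + c) → a (q + d + c) + a q < a (q + d + 1) + a (q + d)
      target-by-range middle quad q c+1≤q q≤ = by-range (q + d ≤? k + c + m) (q + d + c + c ≤? suc k)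
        where
        q≥1 : 1 ≤ q
        q≥1 = ≤-trans (m≤n+m 1 c) c+1≤q
        goal : Set
        goal = a (q + d + c) + a q < a (q + d + 1) + a (q + d)
        by-range : Dec (q + d ≤ k + c + m) → Dec (q + d + c + c ≤ suc k) → goal
        by-range (yes n≤) (yes n+2c≤) = target-identity-range q≥1 n+2c≤
        by-range (yes n≤) (no n+2c≰) =
          target-middle-range q≥1 q+c≤ (middle (q + d) (≤-trans q≥1 (m≤m+n q d)) (≰⇒> n+2c≰) n≤)
          where
          rearrange : ∀ k q c d m → suc k + (q + d + (c + c + m)) ≡ q + c + (k + c + m + suc d) + 0
          rearrange = solve-∀
          q+c≤ : q + c ≤ suc k
          q+c≤ = ≤-by-identity 0 (+-mono-≤ n≤ 2c+m≤1+d) (rearrange k q c d m)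
        by-range (no n≰) _ = target-quadratic-range x q≥1 q+d≡ x≤d (quad x m≤x)
          where
          x : ℕ
          x = q + d ∸ suc (k + c)
          1+k+c+x≡q+d : suc (k + c) + x ≡ q + d
          1+k+c+x≡q+d = m+[n∸m]≡n (≤-trans (s≤s (m≤m+n (k + c) m)) (≰⇒> n≰))
          q+d≡ : q + d ≡ k + suc (c + x)
          q+d≡ = trans (sym 1+k+c+x≡q+d) (sym (trans (+-suc k (c + x)) (cong suc (sym (+-assoc k c x)))))
          m≤x : m ≤ x
          m≤x = +-cancelˡ-≤ (suc (k + c)) m x (subst (suc (k + c) + m ≤_) (sym 1+k+c+x≡q+d) (≰⇒> n≰))
          x≤d : x ≤ d
          x≤d = +-cancelˡ-≤ (suc (k + c)) x d (subst (_≤ suc (k + c) + d) (sym 1+k+c+x≡q+d) (+-monoˡ-≤ d q≤))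

      target-inequality : MiddleBound a k c m d → QuadPositiveFrom c m →
        ∀ n → c + d + 1 ≤ n → n ≤ k + c + 1 + d → a (n + c) + a (n ∸ d) < a (n + 1) + a n
      target-inequality middle quad n lo≤n n≤hi =
        subst (λ i → a (i + c) + a (n ∸ d) < a (i + 1) + a i) q+d≡n
          (target-by-range middle quad (n ∸ d) c+1≤q q≤1+k+c)
        where
        d≤n : d ≤ n
        d≤n = ≤-trans (≤-trans (m≤n+m d c) (m≤m+n (c + d) 1)) lo≤n
        q+d≡n : n ∸ d + d ≡ n
        q+d≡n = m∸n+n≡m d≤n
        c+1≤q : c + 1 ≤ n ∸ d
        c+1≤q = +-cancelʳ-≤ d (c + 1) (n ∸ d)
          (subst₂ _≤_ (trans (+-assoc c d 1) (trans (cong (c +_) (+-comm d 1)) (sym (+-assoc c 1 d))))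
                      (sym q+d≡n) lo≤n)
        q≤1+k+c : n ∸ d ≤ suc (k + c)
        q≤1+k+c = +-cancelʳ-≤ d (n ∸ d) (suc (k + c))
                    (subst₂ _≤_ (sym q+d≡n) (cong (_+ d) (+-comm (k + c) 1)) n≤hi)

module OnIntegers where
  open import Data.Nat as ℕ using (ℕ; suc)
  import Data.Nat.Properties as ℕₚ
  import Data.Nat.Tactic.RingSolver as ℕ-Solver
  open import Data.Integer using (ℤ; +_; _+_; _-_; _*_; -_; _⊔_; _≤_; _<_; +≤+; +<+; ∣_∣)
  open import Data.Integer.Properties
  open import Data.Integer.Tactic.RingSolver using (solve-∀)
  open import Data.List using (List; _∷_; foldr)
  open import Data.List.Membership.Propositional using (_∈_)
  open import Data.List.Membership.Propositional.Properties using (∈-map⁺; ∈-upTo⁺)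
  open import Data.List.Relation.Unary.Any using (here; there)
  open import Data.List.Relation.Unary.All using (All)
  open import Relation.Binary.PropositionalEquality

  ≤-foldr-⊔ : ∀ (g : ℤ → ℤ) z {xs x} → x ∈ xs → g x ≤ foldr (λ j acc → g j ⊔ acc) z xs
  ≤-foldr-⊔ g z (here refl)          = i≤i⊔j _ _
  ≤-foldr-⊔ g z {y ∷ _} (there x∈xs) = ≤-trans (≤-foldr-⊔ g z x∈xs) (i≤j⊔i (g y) _)

  j<clamp : ∀ {z} j → + j + + 1 ≤ z → j ℕ.< clamp z
  j<clamp {+ n} j (+≤+ j+1≤n) = subst (ℕ._≤ n) (ℕₚ.+-comm j 1) j+1≤n

  ∈-rangeZ : ∀ {lo hi i} → lo ≤ i → i ≤ hi → i ∈ rangeZ lo hi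
  ∈-rangeZ {lo} {hi} {i} lo≤i i≤hi =
    subst (_∈ rangeZ lo hi) lo+j≡i (∈-map⁺ (λ t → lo + + t) (∈-upTo⁺ (j<clamp j j+1≤)))
    where
    j : ℕ
    j = ∣ i - lo ∣
    +j≡i-lo : + j ≡ i - lo
    +j≡i-lo = 0≤i⇒+∣i∣≡i (i≤j⇒0≤j-i lo≤i)
    lo+[i-lo]≡i : ∀ lo i → lo + (i - lo) ≡ i
    lo+[i-lo]≡i = solve-∀
    lo+j≡i : lo + + j ≡ i
    lo+j≡i = trans (cong (λ t → lo + t) +j≡i-lo) (lo+[i-lo]≡i lo i)
    j+1≤ : + j + + 1 ≤ hi - lo + + 1
    j+1≤ = subst (λ z → z + + 1 ≤ hi - lo + + 1) (sym +j≡i-lo) (+-monoˡ-≤ (+ 1) (+-monoˡ-≤ (- lo) i≤hi))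

  ≤-maxOver : ∀ {lo hi i} (g : ℤ → ℤ) → lo ≤ i → i ≤ hi → g i ≤ maxOver lo hi g
  ≤-maxOver g lo≤i i≤hi = ≤-foldr-⊔ g _ (∈-rangeZ lo≤i i≤hi)

  +-cancelʳ-≤ : ∀ {i j} k → i + k ≤ j + k → i ≤ j
  +-cancelʳ-≤ {i} {j} k i+k≤j+k = subst₂ _≤_ (i+k-k≡i i k) (i+k-k≡i j k) (+-monoˡ-≤ (- k) i+k≤j+k)
    where
    i+k-k≡i : ∀ i k → i + k - k ≡ i
    i+k-k≡i = solve-∀

  private
    i-j+[j+k]≡i+k : ∀ i j k → i - j + (j + k) ≡ i + k
    i-j+[j+k]≡i+k = solve-∀
    i-k+[j+k]≡i+j : ∀ i j k → i - k + (j + k) ≡ i + j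
    i-k+[j+k]≡i+j = solve-∀

  [m-n]≤[o-p] : ∀ {m n o p} → m ℕ.+ p ℕ.≤ o ℕ.+ n → + m - + n ≤ + o - + p
  [m-n]≤[o-p] {m} {n} {o} {p} m+p≤o+n = +-cancelʳ-≤ (+ n + + p)
    (subst₂ _≤_ (sym (i-j+[j+k]≡i+k (+ m) (+ n) (+ p))) (sym (i-k+[j+k]≡i+j (+ o) (+ n) (+ p))) (+≤+ m+p≤o+n))

  [m-n]≤[o-p]⁻¹ : ∀ {m n o p} → + m - + n ≤ + o - + p → m ℕ.+ p ℕ.≤ o ℕ.+ n
  [m-n]≤[o-p]⁻¹ {m} {n} {o} {p} m-n≤o-p = drop‿+≤+
    (subst₂ _≤_ (i-j+[j+k]≡i+k (+ m) (+ n) (+ p)) (i-k+[j+k]≡i+j (+ o) (+ n) (+ p))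
                (+-monoˡ-≤ (+ n + + p) m-n≤o-p))

  [m-n]≤o : ∀ {m n o} → m ℕ.≤ o ℕ.+ n → + m - + n ≤ + o
  [m-n]≤o {m} {n} {o} m≤o+n =
    subst (+ m - + n ≤_) (+-identityʳ (+ o))
      ([m-n]≤[o-p] {m} {n} {o} {0} (subst (ℕ._≤ o ℕ.+ n) (sym (ℕₚ.+-identityʳ m)) m≤o+n))

  [m-n]≤o⁻¹ : ∀ {m n o} → + m - + n ≤ + o → m ℕ.≤ o ℕ.+ n
  [m-n]≤o⁻¹ {m} {n} {o} m-n≤o =
    subst (ℕ._≤ o ℕ.+ n) (ℕₚ.+-identityʳ m)
      ([m-n]≤[o-p]⁻¹ {m} {n} {o} {0} (subst (+ m - + n ≤_) (sym (+-identityʳ (+ o))) m-n≤o))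

  m-n≡m∸n : ∀ {m n} → n ℕ.≤ m → + m - + n ≡ + (m ℕ.∸ n)
  m-n≡m∸n {m} {n} n≤m = trans (m-n≡m⊖n m n) (⊖-≥ n≤m)

  quad2-as-difference : ∀ c x →
    quad2 c (+ x) ≡ + (x ℕ.* x ℕ.+ 3 ℕ.* x ℕ.+ 2 ℕ.+ c) - + (2 ℕ.* c ℕ.* x ℕ.+ 3 ℕ.* c ℕ.* c)
  quad2-as-difference c x = begin
    quad2 c (+ x)
      ≡⟨ cong₂ (λ u v → + x * + x + (+ 3 - u) * + x + (+ 2 + + c - v))
               (pos-* 2 c) (trans (pos-* (3 ℕ.* c) c) (cong (_* + c) (pos-* 3 c))) ⟩
    + x * + x + (+ 3 - + 2 * + c) * + x + (+ 2 + + c - + 3 * + c * + c)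
      ≡⟨ expand (+ x) (+ c) ⟩
    (+ x * + x + + 3 * + x + + 2 + + c) - (+ 2 * + c * + x + + 3 * + c * + c)
      ≡⟨ cong₂ (λ u v → u - v)
               (cong₂ (λ u v → u + v + + 2 + + c) (pos-* x x) (pos-* 3 x))
               (cong₂ _+_ (trans (pos-* (2 ℕ.* c) x) (cong (_* + x) (pos-* 2 c)))
                          (trans (pos-* (3 ℕ.* c) c) (cong (_* + c) (pos-* 3 c)))) ⟨
    + (x ℕ.* x ℕ.+ 3 ℕ.* x ℕ.+ 2 ℕ.+ c) - + (2 ℕ.* c ℕ.* x ℕ.+ 3 ℕ.* c ℕ.* c) ∎
    where
    open ≡-Reasoning
    expand : ∀ x c → x * x + (+ 3 - + 2 * c) * x + (+ 2 + c - + 3 * c * c)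
                   ≡ (x * x + + 3 * x + + 2 + c) - (+ 2 * c * x + + 3 * c * c)
    expand = solve-∀

  PosFrom⇒QuadPositiveFrom : ∀ {c m} → PosFrom c m → OnNaturals.QuadPositiveFrom c m
  PosFrom⇒QuadPositiveFrom {c} pos x m≤x = drop‿+<+ (subst (+ B <_) (i-j+j≡i (+ A) (+ B))
    (+-monoˡ-< (+ B) (subst (+ 0 <_) (quad2-as-difference c x) (pos (+ x) (+≤+ m≤x)))))
    where
    A B : ℕ
    A = x ℕ.* x ℕ.+ 3 ℕ.* x ℕ.+ 2 ℕ.+ c
    B = 2 ℕ.* c ℕ.* x ℕ.+ 3 ℕ.* c ℕ.* c
    i-j+j≡i : ∀ i j → i - j + j ≡ i
    i-j+j≡i = solve-∀

  module FTSequence (T : List ℕ) (c : ℕ) (f : ℤ → ℤ) (isFT : IsFT T c f) (k : ℕ) (k≥1 : 1 ℕ.≤ k)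
                    (a : ℕ → ℕ) (lid : IsLID (Sk k T) a) where

    f[p-k]≡a[p]-k : ∀ {p} → 1 ℕ.≤ p → p ℕ.+ 2 ℕ.* c ℕ.≤ k ℕ.+ (k ℕ.+ 1) → f (+ p - + k) ≡ + a p - + k
    f[p-k]≡a[p]-k {suc p} _ bound = begin
      f (+ suc p - + k)                   ≡⟨ k+i-k≡i (+ k) _ ⟨
      + k + f (+ suc p - + k) - + k       ≡⟨ cong (_- + k) (isFT (+ suc p - + k) k a k≥1 k>-i k≥i+2c-1 lid) ⟨
      at a (+ k + (+ suc p - + k)) - + k  ≡⟨ cong (λ z → at a z - + k) (k+[p-k]≡p (+ k) (+ suc p)) ⟩
      + a (suc p) - + k                   ∎
      where
      open ≡-Reasoning
      k+i-k≡i : ∀ k i → k + i - k ≡ i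
      k+i-k≡i = solve-∀
      k+[p-k]≡p : ∀ k p → k + (p - k) ≡ p
      k+[p-k]≡p = solve-∀
      -[p-k]≡k-p : ∀ p k → - (p - k) ≡ k - p
      -[p-k]≡k-p = solve-∀
      regroup : ∀ p k c o → p - k + c - o ≡ (p + c) - (k + o)
      regroup = solve-∀
      k>-i : - (+ suc p - + k) < + k
      k>-i = subst (_< + k) (sym (-[p-k]≡k-p (+ suc p) (+ k))) (m⊖1+n<m k (suc p))
      k≥i+2c-1 : + suc p - + k + + (2 ℕ.* c) - + 1 ≤ + k
      k≥i+2c-1 = subst (_≤ + k) (sym (regroup (+ suc p) (+ k) (+ (2 ℕ.* c)) (+ 1))) ([m-n]≤o bound)

    middle-range : ∀ {m d} → 1 ℕ.≤ c → m ℕ.≤ d → 4 ℕ.* c ℕ.+ d ℕ.+ 1 ℕ.≤ k →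
      (∀ i → + 2 - + (2 ℕ.* c) ≤ i → i ≤ + c + + m → f (i + + c) - f i - f (i + + 1) + i + + 1 ≤ + d) →
      OnNaturals.MiddleBound a k c m d
    middle-range {m} {d} c≥1 m≤d 4c+d<k f-bound n n≥1 k+1<n+2c n≤k+c+m =
      subst (a (n ℕ.+ c) ℕ.+ n ℕ.+ 1 ℕ.≤_) (sym (ℕₚ.+-assoc d (a n) (a (n ℕ.+ 1))))
        ([m-n]≤o⁻¹ (subst (_≤ + d) difference≡ (f-bound i lo≤i i≤hi)))
      where
      i : ℤ
      i = + n - + k
      n+c+c≡n+2c : ∀ n c → n ℕ.+ c ℕ.+ c ≡ n ℕ.+ 2 ℕ.* c
      n+c+c≡n+2c = ℕ-Solver.solve-∀
      lo≤i : + 2 - + (2 ℕ.* c) ≤ i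
      lo≤i = [m-n]≤[o-p] {2} {2 ℕ.* c} {n} {k} (subst (suc (suc k) ℕ.≤_) (n+c+c≡n+2c n c) k+1<n+2c)
      i≤hi : i ≤ + c + + m
      i≤hi = [m-n]≤o (subst (n ℕ.≤_) (trans (ℕₚ.+-assoc k c m) (ℕₚ.+-comm k (c ℕ.+ m))) n≤k+c+m)
      within : ∀ p → p ℕ.≤ n ℕ.+ c → p ℕ.+ 2 ℕ.* c ℕ.≤ k ℕ.+ (k ℕ.+ 1)
      within p p≤n+c = ℕₚ.≤-trans (ℕₚ.+-monoˡ-≤ (2 ℕ.* c) p≤n+c)
        (OnNaturals.≤-by-identity 2 (ℕₚ.+-mono-≤ (ℕₚ.+-mono-≤ n≤k+c+m m≤d) 4c+d<k) (balance n c k m d))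
        where
        balance : ∀ n c k m d → k ℕ.+ (k ℕ.+ 1) ℕ.+ (n ℕ.+ m ℕ.+ (4 ℕ.* c ℕ.+ d ℕ.+ 1))
                              ≡ n ℕ.+ c ℕ.+ 2 ℕ.* c ℕ.+ (k ℕ.+ c ℕ.+ m ℕ.+ d ℕ.+ k) ℕ.+ 2
        balance = ℕ-Solver.solve-∀
      shift : ∀ p k c → p - k + c ≡ (p + c) - k
      shift = solve-∀
      F₀ : f i ≡ + a n - + k
      F₀ = f[p-k]≡a[p]-k n≥1 (within n (ℕₚ.m≤m+n n c))
      F₊c : f (i + + c) ≡ + a (n ℕ.+ c) - + k
      F₊c = trans (cong f (shift (+ n) (+ k) (+ c)))
                  (f[p-k]≡a[p]-k (ℕₚ.≤-trans n≥1 (ℕₚ.m≤m+n n c)) (within _ ℕₚ.≤-refl))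
      F₊₁ : f (i + + 1) ≡ + a (n ℕ.+ 1) - + k
      F₊₁ = trans (cong f (shift (+ n) (+ k) (+ 1)))
                  (f[p-k]≡a[p]-k (ℕₚ.m≤n+m 1 n) (within _ (ℕₚ.+-monoʳ-≤ n c≥1)))
      cancel-k : ∀ X Y₀ Y₁ N K O → (X - K) - (Y₀ - K) - (Y₁ - K) + (N - K) + O ≡ (X + N + O) - (Y₀ + Y₁)
      cancel-k = solve-∀
      difference≡ : f (i + + c) - f i - f (i + + 1) + i + + 1
                  ≡ + (a (n ℕ.+ c) ℕ.+ n ℕ.+ 1) - + (a n ℕ.+ a (n ℕ.+ 1))
      difference≡ rewrite F₊c | F₀ | F₊₁ = cancel-k (+ a (n ℕ.+ c)) (+ a n) (+ a (n ℕ.+ 1)) (+ n) (+ k) (+ 1)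

  dVal≥2c+m-1 : ∀ {c m} f → 1 ℕ.≤ c → + (2 ℕ.* c ℕ.+ m ℕ.∸ 1) ≤ dVal c m f
  dVal≥2c+m-1 {c} {m} f c≥1 =
    subst (_≤ dVal c m f) (m-n≡m∸n (ℕₚ.≤-trans c≥1 (ℕₚ.≤-trans (ℕₚ.m≤m+n c _) (ℕₚ.m≤m+n (2 ℕ.* c) m))))
      (i≤i⊔j _ _)

  dVal≥middle-difference : ∀ {c m} f i → + 2 - + (2 ℕ.* c) ≤ i → i ≤ + c + + m →
    f (i + + c) - f i - f (i + + 1) + i + + 1 ≤ dVal c m f
  dVal≥middle-difference {c} f i lo≤i i≤hi =
    ≤-trans (≤-maxOver (λ j → f (j + + c) - f j - f (j + + 1) + j + + 1) lo≤i i≤hi) (i≤j⊔i _ _)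

  inequality-for-natural-d : (T : List ℕ) (c : ℕ) → All (1 ℕ.≤_) T → 1 ℕ.≤ c → All (ℕ._≤ c) T →
    (f : ℤ → ℤ) → IsFT T c f → (m : ℕ) → PosFrom c m → (d : ℕ) → 2 ℕ.* c ℕ.+ m ℕ.∸ 1 ℕ.≤ d →
    (∀ i → + 2 - + (2 ℕ.* c) ≤ i → i ≤ + c + + m → f (i + + c) - f i - f (i + + 1) + i + + 1 ≤ + d) →
    (k : ℕ) → + (4 ℕ.* c) + + d + + 1 ≤ + k → (a : ℕ → ℕ) → IsLID (Sk k T) a →
    (n : ℤ) → + c + + d + + 1 ≤ n → n ≤ + k + + c + + 1 + + d →
    at a (n + + c) + at a (n - + d) < at a (n + + 1) + at a n
  inequality-for-natural-d T c T≥1 c≥1 T≤c f isFT m posFrom d 2c+m-1≤d bounded k (+≤+ 4c+d<k) a lid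
                           (+ n) (+≤+ lo≤n) (+≤+ n≤hi) =
    subst (λ z → + a (n ℕ.+ c) + at a z < + a (n ℕ.+ 1) + + a n) (sym (m-n≡m∸n d≤n))
      (+<+ (OnNaturals.SkSequence.target-inequality T c k T≥1 T≤c k≥1 a lid c≥1 2c+m≤1+d 4c+d<k
             (FTSequence.middle-range T c f isFT k k≥1 a lid c≥1 m≤d 4c+d<k bounded)
             (PosFrom⇒QuadPositiveFrom posFrom) n lo≤n n≤hi))
    where
    k≥1 : 1 ℕ.≤ k
    k≥1 = ℕₚ.≤-trans (ℕₚ.m≤n+m 1 _) 4c+d<k
    d≤n : d ℕ.≤ n
    d≤n = ℕₚ.≤-trans (ℕₚ.≤-trans (ℕₚ.m≤n+m d c) (ℕₚ.m≤m+n (c ℕ.+ d) 1)) lo≤n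
    2c+m≤1+d : c ℕ.+ c ℕ.+ m ℕ.≤ suc d
    2c+m≤1+d = subst (ℕ._≤ suc d) (cong (λ z → c ℕ.+ z ℕ.+ m) (ℕₚ.+-identityʳ c))
                 (ℕₚ.≤-trans (ℕₚ.m≤n+m∸n (2 ℕ.* c ℕ.+ m) 1) (ℕ.s≤s 2c+m-1≤d))
    m≤d : m ℕ.≤ d
    m≤d = ℕₚ.≤-pred (ℕₚ.≤-trans (ℕₚ.+-monoˡ-≤ m (ℕₚ.≤-trans c≥1 (ℕₚ.m≤m+n c c))) 2c+m≤1+d)

open import Data.Nat using (ℕ; _≤_)
open import Data.Integer using (ℤ; +_; -[1+_]; _+_; _-_; _<_; +≤+)
open import Data.List using (List)
open import Data.List.Membership.Propositional using (_∈_)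
open import Data.List.Relation.Unary.All as All using (All)
open import Data.Product using (_,_)
open OnIntegers using (dVal≥2c+m-1; dVal≥middle-difference; inequality-for-natural-d)

lemma3p9 : (T : List ℕ) (c : ℕ) → All (λ t → 1 ≤ t) T → c ∈ T → All (λ t → t ≤ c) T →
  (f : ℤ → ℤ) → IsFT T c f →
  (m : ℕ) → IsM c m →
  (k : ℕ) → + (4 Data.Nat.* c) + dVal c m f + + 1 Data.Integer.≤ + k →
  kBound c (dVal c m f) f < + k →
  (a : ℕ → ℕ) → IsLID (Sk k T) a →
  (n : ℤ) → + c + dVal c m f + + 1 Data.Integer.≤ n →
  n Data.Integer.≤ + k + + c + + 1 + dVal c m f →
  at a (n + + c) + at a (n - dVal c m f) < at a (n + + 1) + at a n
lemma3p9 T c T≥1 c∈T T≤c f isFT m (posFrom , _) k 4c+d<k _ a lid n lo≤n n≤hi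
  with dVal c m f | dVal≥2c+m-1 {c} {m} f (All.lookup T≥1 c∈T) | dVal≥middle-difference {c} {m} f
... | -[1+ _ ] | ()              | _
... | + d      | +≤+ 2c+m-1≤d    | bounded =
  inequality-for-natural-d T c T≥1 (All.lookup T≥1 c∈T) T≤c f isFT m posFrom d 2c+m-1≤d bounded
    k 4c+d<k a lid n lo≤n n≤hi
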